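{- Let $V=[n]$, $k\ge1$, $\varepsilon\in(0,1)$, positive integers $B_1,\dots,B_k$ with $B=\sum_{i\in[k]}B_i\le n$, and let $F:(k+1)^V\to\mathbb{R}_{\ge0}$ be $\varepsilon$-approximately $k$-submodular. Let $\mathbf{x}$ be the output of $k$-Greedy-IS applied to $F$ and $B_1,\dots,B_k$. Then $F(\mathbf{x})\ge\frac{(1-\varepsilon)^2}{(3-3\varepsilon+2\varepsilon B)(1+\varepsilon)}\max\{F(\mathbf{y}):\mathbf{y}\in(k+1)^V,\ |\mathrm{supp}_i(\mathbf{y})|\le B_i\ \forall i\in[k]\}$.
   Context: $(k+1)^V$ is the set of $k$-tuples $\mathbf{x}=(X_1,\dots,X_k)$ of pairwise disjoint subsets of $V$ (identified with $\mathbf{x}\in\{0,\dots,k\}^V$, $\mathbf{x}(e)=i\iff e\in X_i$); $\mathbf{0}$ is the all-empty tuple; $\mathrm{supp}(\mathbf{x})=\bigcup_iX_i$, $\mathrm{supp}_i(\mathbf{x})=X_i$; $\mathbf{x}\preceq\mathbf{y}$ iff $X_i\subseteq Y_i$ $\forall i$; $\Delta_{u,i}g(\mathbf{x})=g(X_1,\dots,X_i\cup\{u\},\dots,X_k)-g(\mathbf{x})$ for $u\notin\mathrm{supp}(\mathbf{x})$. $f$ is $k$-submodular if $\Delta_{u,i}f(\mathbf{x})\ge\Delta_{u,i}f(\mathbf{y})$ for $\mathbf{x}\preceq\mathbf{y}$, $u\notin\mathrm{supp}(\mathbf{y})$, and $\Delta_{u,i}f(\mathbf{x})+\Delta_{u,j}f(\mathbf{x})\ge0$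 for $i\ne j$; monotone if $\mathbf{x}\preceq\mathbf{y}\Rightarrow f(\mathbf{x})\le f(\mathbf{y})$. $F$ is $\varepsilon$-approximately $k$-submodular if there is a monotone $k$-submodular $f$ with $(1-\varepsilon)f(\mathbf{x})\le F(\mathbf{x})\le(1+\varepsilon)f(\mathbf{x})$ for all $\mathbf{x}$; $F(\mathbf{0})=f(\mathbf{0})=0$. $k$-Greedy-IS: start with $\mathbf{x}=\mathbf{0}$, $I=[k]$; while $I\ne\emptyset$: pick $(e,i)\in\arg\max_{e\in V\setminus\mathrm{supp}(\mathbf{x}),\,i\in I}\Delta_{e,i}F(\mathbf{x})$ (ties arbitrary), set $\mathbf{x}(e)=i$, and if $|\mathrm{supp}_i(\mathbf{x})|=B_i$ remove $i$ from $I$; output $\mathbf{x}$. -}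

module Defs where

open import Data.Nat as ℕ using (ℕ; zero; suc)
open import Data.Fin using (Fin; _≟_)
open import Data.Maybe using (Maybe; just; nothing)
open import Data.Bool using (Bool; true; false; if_then_else_; _∧_; not)
open import Data.List using (List; length; filter; allFin; map)
open import Data.Nat.ListAction using (sum)
open import Data.Product using (Σ; ∃; _×_; _,_)
open import Relation.Nullary using (¬_)
open import Relation.Nullary.Decidable using (⌊_⌋)
open import Relation.Binary.PropositionalEquality using (_≡_; _≢_)
open import Algebra.Structures using (IsCommutativeRing)
open import Relation.Binary.Structures using (IsTotalOrder)
open import Relation.Binary.Construct.Closure.ReflexiveTransitive using (Star)

-- Ordered fields (the reals are one; the statement is made for every
-- ordered field, in particular for ℝ).

record OrderedField : Set₁ where
  infixl 6 _+_ _-_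
  infixl 7 _*_
  infix 4 _≤_ _<_
  field
    Carrier : Set
    _+_ _*_ : Carrier → Carrier → Carrier
    -_ : Carrier → Carrier
    0# 1# : Carrier
    _≤_ : Carrier → Carrier → Set
    isCommutativeRing : IsCommutativeRing _≡_ _+_ _*_ -_ 0# 1#
    _⁻¹ : Carrier → Carrier
    ⁻¹-inverse : ∀ x → x ≢ 0# → x * (x ⁻¹) ≡ 1#
    0≢1 : 0# ≢ 1#
    isTotalOrder : IsTotalOrder _≡_ _≤_
    +-monoˡ-≤ : ∀ {x y} z → x ≤ y → x + z ≤ y + z
    *-nonneg : ∀ {x y} → 0# ≤ x → 0# ≤ y → 0# ≤ x * y

  _-_ : Carrier → Carrier → Carrier
  x - y = x + (- y)

  _<_ : Carrier → Carrier → Set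
  x < y = (x ≤ y) × (x ≢ y)

  fromℕ : ℕ → Carrier
  fromℕ zero = 0#
  fromℕ (suc m) = 1# + fromℕ m

-- (k+1)^V with V = Fin n : x e = nothing means e ∉ supp x,
-- x e = just i means e ∈ X_i (i ∈ Fin k, i.e. [k] zero-indexed).

KTuple : ℕ → ℕ → Set
KTuple n k = Fin n → Maybe (Fin k)

zeroT : ∀ {n k} → KTuple n k
zeroT _ = nothing

update : ∀ {n k} → KTuple n k → Fin n → Fin k → KTuple n k
update x e i e' = if ⌊ e' ≟ e ⌋ then just i else x e'

_≼_ : ∀ {n k} → KTuple n k → KTuple n k → Set
x ≼ y = ∀ e i → x e ≡ just i → y e ≡ just i

isIn : ∀ {k} → Fin k → Maybe (Fin k) → Bool
isIn i nothing = false
isIn i (just j) = ⌊ j ≟ i ⌋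

cardᵢ : ∀ {n k} → KTuple n k → Fin k → ℕ
cardᵢ {n} x i = length (filter (λ e → isIn i (x e) ≟b true) (allFin n))
  where
  open import Data.Bool.Properties using () renaming (_≟_ to _≟b_)

module _ (R : OrderedField) where
  open OrderedField R

  Δ : ∀ {n k} → (KTuple n k → Carrier) → KTuple n k → Fin n → Fin k → Carrier
  Δ g x e i = g (update x e i) - g x

  Monotone : ∀ {n k} → (KTuple n k → Carrier) → Set
  Monotone f = ∀ x y → x ≼ y → f x ≤ f y

  KSubmodular : ∀ {n k} → (KTuple n k → Carrier) → Set
  KSubmodular {n} {k} f =
    (∀ x y → x ≼ y → ∀ (u : Fin n) → y u ≡ nothing → ∀ (i : Fin k) →
       Δ f y u i ≤ Δ f x u i)
    × (∀ x (u : Fin n) → x u ≡ nothing → ∀ (i j : Fin k) → i ≢ j →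
       0# ≤ Δ f x u i + Δ f x u j)

  ApproxKSubmodular : ∀ {n k} → Carrier → (KTuple n k → Carrier) → Set
  ApproxKSubmodular {n} {k} ε F =
    Σ (KTuple n k → Carrier) λ f →
      Monotone f × KSubmodular f × f zeroT ≡ 0# × F zeroT ≡ 0#
      × (∀ x → ((1# - ε) * f x ≤ F x) × (F x ≤ (1# + ε) * f x))

  -- k-Greedy-IS: a state is (x , I) with I ⊆ [k] as a Boolean predicate.
  GState : ℕ → ℕ → Set
  GState n k = KTuple n k × (Fin k → Bool)

  -- one iteration of the while loop (ties broken arbitrarily)
  GreedyStep : ∀ {n k} → (KTuple n k → Carrier) → (Fin k → ℕ) →
               GState n k → GState n k → Set
  GreedyStep {n} {k} F B (x , I) (x' , I') =
    Σ (Fin n) λ e → Σ (Fin k) λ i →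
      x e ≡ nothing × I i ≡ true
      × (∀ e' i' → x e' ≡ nothing → I i' ≡ true → Δ F x e' i' ≤ Δ F x e i)
      × x' ≡ update x e i
      × I' ≡ (λ j → if ⌊ j ≟ i ⌋ ∧ ⌊ cardᵢ x' i ℕ.≟ B i ⌋ then false else I j)

  -- x is an output of k-Greedy-IS (for some choice of ties): a run from
  -- (0 , [k]) ending when I = ∅.
  GreedyOutput : ∀ {n k} → (KTuple n k → Carrier) → (Fin k → ℕ) → KTuple n k → Set
  GreedyOutput {n} {k} F B x =
    Σ (Fin k → Bool) λ I →
      Star (GreedyStep F B) (zeroT , (λ _ → true)) (x , I)
      × (∀ j → I j ≡ false)

totalB : ∀ {k} → (Fin k → ℕ) → ℕ
totalB {k} B = sum (map B (allFin k))

module Submission where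

-- With a = 1 - ε, G = f(x) for the greedy output x and |z| the number of elements placed by z,
-- every tuple x_j of the run and every feasible o ⪰ x_j satisfy the potential inequality
--   a f(o) + 2 a f(x_j) + 2εG |x_j| ≤ 3 a G + 2εG |o|.
-- At the end of the run every colour is full, so o = x and the inequality is plain monotonicity.
-- Along a greedy step x ↦ x + (e,i), o is turned into o′ ⪰ x + (e,i) by erasing o(e) and, if colour i
-- is then full, one element of colour i outside x, and finally putting e into colour i. The colours
-- erased are still active, so diminishing returns and the greedy choice bound the loss of each erasure
-- by a f(x + (e,i)) - a f(x) + 2εG; at most two erasures happen, and each lowers |o| - |x| by one,
-- which pays for its 2εG. At the start (x₀ = 0, o = y) this gives a f(y) ≤ (3a + 2εB) G,
-- and F ≥ a f, F ≤ (1 + ε) f turn it into the stated bound.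

open import Defs
open import Data.Nat as ℕ using (ℕ; zero; suc; z≤n; s≤s)
open import Data.Nat.Properties as ℕ using (+-0-commutativeMonoid)
open import Data.Fin using (Fin; _≟_) renaming (zero to fzero; suc to fsuc)
open import Data.Fin.Properties using (punchInᵢ≢i)
open import Data.Bool using (Bool; true; false; if_then_else_; _∧_)
open import Data.Maybe using (Maybe; just; nothing)
open import Algebra.Bundles using (CommutativeRing)
open import Relation.Binary.Bundles using (Poset)
open import Relation.Binary.Structures using (IsTotalOrder)
open import Relation.Binary.Construct.Closure.ReflexiveTransitive using (Star; _◅_) renaming (ε to ε⋆)
import Relation.Binary.Reasoning.PartialOrder
open import Relation.Nullary.Decidable using (⌊_⌋)
open import Data.Bool.Properties using () renaming (_≟_ to _≟ᵇ_)
open import Data.List using (length; filter; map; tabulate)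
import Data.Nat.ListAction as List
open import Data.Product using (∃; _×_; _,_; proj₁; proj₂)
open import Data.Sum using (inj₁; inj₂)
open import Data.Vec.Functional using (removeAt)
open import Function using (_∘_)
open import Relation.Nullary using (yes; no; contradiction)
open import Relation.Binary.PropositionalEquality
  using (_≡_; _≢_; refl; sym; trans; cong; cong₂; subst; subst₂; ≢-sym; module ≡-Reasoning)
open import Data.Nat.Tactic.RingSolver using (solve-∀)
open import Algebra.Properties.CommutativeMonoid.Sum +-0-commutativeMonoid
  using (sum; sum-syntax; sum-cong-≗; sum-remove; sum-replicate-zero; ∑-comm)

fromBool : Bool → ℕ
fromBool true = 1
fromBool false = 0

∑-mono-≤ : ∀ {m} {f g : Fin m → ℕ} → (∀ j → f j ℕ.≤ g j) → sum f ℕ.≤ sum g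
∑-mono-≤ {zero} f≤g = z≤n
∑-mono-≤ {suc m} f≤g = ℕ.+-mono-≤ (f≤g fzero) (∑-mono-≤ (f≤g ∘ fsuc))

∑-mono-< : ∀ {m} {f g : Fin m → ℕ} → (∀ j → f j ℕ.≤ g j) → ∀ e → f e ℕ.< g e → sum f ℕ.< sum g
∑-mono-< f≤g fzero fe<ge = ℕ.+-mono-<-≤ fe<ge (∑-mono-≤ (f≤g ∘ fsuc))
∑-mono-< f≤g (fsuc e) fe<ge = ℕ.+-mono-≤-< (f≤g fzero) (∑-mono-< (f≤g ∘ fsuc) e fe<ge)

∑-<⇒∃< : ∀ {m} (f g : Fin m → ℕ) → sum f ℕ.< sum g → ∃ λ j → f j ℕ.< g j
∑-<⇒∃< {zero} f g ()
∑-<⇒∃< {suc m} f g ∑f<∑g with f fzero ℕ.<? g fzero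
... | yes f₀<g₀ = fzero , f₀<g₀
... | no f₀≮g₀ with ∑-<⇒∃< (f ∘ fsuc) (g ∘ fsuc)
                      (ℕ.+-cancelˡ-< (g fzero) _ _ (ℕ.≤-<-trans (ℕ.+-monoˡ-≤ _ (ℕ.≮⇒≥ f₀≮g₀)) ∑f<∑g))
...   | j , fj<gj = fsuc j , fj<gj

∑-update : ∀ {m} (f g : Fin m → ℕ) e → (∀ j → j ≢ e → f j ≡ g j) → sum f ℕ.+ g e ≡ sum g ℕ.+ f e
∑-update {suc m} f g e f≗g = begin
  sum f ℕ.+ g e                        ≡⟨ cong (ℕ._+ g e) (sum-remove {i = e} f) ⟩
  f e ℕ.+ sum (removeAt f e) ℕ.+ g e   ≡⟨ cong (λ s → f e ℕ.+ s ℕ.+ g e) rest ⟩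
  f e ℕ.+ sum (removeAt g e) ℕ.+ g e   ≡⟨ swap-outer (f e) _ (g e) ⟩
  g e ℕ.+ sum (removeAt g e) ℕ.+ f e   ≡⟨ cong (ℕ._+ f e) (sum-remove {i = e} g) ⟨
  sum g ℕ.+ f e                        ∎
  where
  open ≡-Reasoning
  rest : sum (removeAt f e) ≡ sum (removeAt g e)
  rest = sum-cong-≗ (λ j → f≗g _ (punchInᵢ≢i e j))
  swap-outer : ∀ a s b → a ℕ.+ s ℕ.+ b ≡ b ℕ.+ s ℕ.+ a
  swap-outer = solve-∀

length-filter-tabulate : ∀ {m} {A : Set} (P : A → Bool) (g : Fin m → A) →
  length (filter (λ a → P a ≟ᵇ true) (tabulate g)) ≡ ∑[ j < m ] fromBool (P (g j))
length-filter-tabulate {zero} P g = refl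
length-filter-tabulate {suc m} P g with P (g fzero)
... | true = cong suc (length-filter-tabulate P (g ∘ fsuc))
... | false = length-filter-tabulate P (g ∘ fsuc)

listSum-map-tabulate : ∀ {m} {A : Set} (h : A → ℕ) (g : Fin m → A) →
                       List.sum (map h (tabulate g)) ≡ ∑[ j < m ] h (g j)
listSum-map-tabulate {zero} h g = refl
listSum-map-tabulate {suc m} h g = cong (h (g fzero) ℕ.+_) (listSum-map-tabulate h (g ∘ fsuc))

totalB≡∑ : ∀ {k} (B : Fin k → ℕ) → totalB B ≡ sum B
totalB≡∑ B = listSum-map-tabulate B (λ j → j)

module _ {k : ℕ} where

  hits : Fin k → Maybe (Fin k) → ℕ
  hits t m = fromBool (isIn t m)

  size : Maybe (Fin k) → ℕ
  size nothing = 0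
  size (just _) = 1

  hits-self : ∀ t → hits t (just t) ≡ 1
  hits-self t with t ≟ t
  ... | yes _ = refl
  ... | no t≢t = contradiction refl t≢t

  hits-other : ∀ {s t} → s ≢ t → hits t (just s) ≡ 0
  hits-other {s} {t} s≢t with s ≟ t
  ... | yes s≡t = contradiction s≡t s≢t
  ... | no _ = refl

  hits⇒≡ : ∀ {s t} → 0 ℕ.< hits t (just s) → s ≡ t
  hits⇒≡ {s} {t} h with s ≟ t
  ... | yes s≡t = s≡t
  ... | no _ = contradiction h (ℕ.n≮n 0)

  size≡∑hits : ∀ m → size m ≡ ∑[ t < k ] hits t m
  size≡∑hits nothing = sym (sum-replicate-zero k)
  size≡∑hits (just s) = sym (ℕ.+-cancelʳ-≡ 0 _ _ (begin
    ∑[ t < k ] hits t (just s) ℕ.+ 0   ≡⟨ ∑-update _ (λ _ → 0) s (λ t t≢s → hits-other (≢-sym t≢s)) ⟩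
    ∑[ t < k ] 0 ℕ.+ hits s (just s)   ≡⟨ cong₂ ℕ._+_ (sum-replicate-zero k) (hits-self s) ⟩
    1 ℕ.+ 0                            ∎))
    where open ≡-Reasoning

  size≤1 : ∀ m → size m ℕ.≤ 1
  size≤1 nothing = z≤n
  size≤1 (just _) = s≤s z≤n

module _ {n k : ℕ} where

  set : KTuple n k → Fin n → Maybe (Fin k) → KTuple n k
  set x e m e′ = if ⌊ e′ ≟ e ⌋ then m else x e′

  erase : KTuple n k → Fin n → KTuple n k
  erase x e = set x e nothing

  set-here : ∀ (x : KTuple n k) e m → set x e m e ≡ m
  set-here x e m with e ≟ e
  ... | yes _ = refl
  ... | no e≢e = contradiction refl e≢e

  set-there : ∀ (x : KTuple n k) e m {e′} → e′ ≢ e → set x e m e′ ≡ x e′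
  set-there x e m {e′} e′≢e with e′ ≟ e
  ... | yes e′≡e = contradiction e′≡e e′≢e
  ... | no _ = refl

  suppSize : KTuple n k → ℕ
  suppSize x = ∑[ e < n ] size (x e)

  cardᵢ≡∑hits : ∀ (x : KTuple n k) t → cardᵢ x t ≡ ∑[ e < n ] hits t (x e)
  cardᵢ≡∑hits x t = length-filter-tabulate (λ e → isIn t (x e)) (λ e → e)

  cardᵢ-set : ∀ (x : KTuple n k) e m t → cardᵢ (set x e m) t ℕ.+ hits t (x e) ≡ cardᵢ x t ℕ.+ hits t m
  cardᵢ-set x e m t = begin
    cardᵢ (set x e m) t ℕ.+ hits t (x e)                  ≡⟨ cong (ℕ._+ _) (cardᵢ≡∑hits (set x e m) t) ⟩
    ∑[ j < n ] hits t (set x e m j) ℕ.+ hits t (x e)      ≡⟨ ∑-update _ _ e (λ j j≢e → cong (hits t) (set-there x e m j≢e)) ⟩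
    ∑[ j < n ] hits t (x j) ℕ.+ hits t (set x e m e)      ≡⟨ cong₂ ℕ._+_ (sym (cardᵢ≡∑hits x t)) (cong (hits t) (set-here x e m)) ⟩
    cardᵢ x t ℕ.+ hits t m                                ∎
    where open ≡-Reasoning

  suppSize-set : ∀ (x : KTuple n k) e m → suppSize (set x e m) ℕ.+ size (x e) ≡ suppSize x ℕ.+ size m
  suppSize-set x e m = trans (∑-update _ _ e (λ j j≢e → cong size (set-there x e m j≢e)))
                             (cong (suppSize x ℕ.+_) (cong size (set-here x e m)))

  suppSize≡∑cardᵢ : ∀ x → suppSize x ≡ ∑[ t < k ] cardᵢ x t
  suppSize≡∑cardᵢ x = begin
    ∑[ e < n ] size (x e)                 ≡⟨ sum-cong-≗ (λ e → size≡∑hits (x e)) ⟩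
    ∑[ e < n ] ∑[ t < k ] hits t (x e)    ≡⟨ ∑-comm (λ e t → hits t (x e)) ⟩
    ∑[ t < k ] ∑[ e < n ] hits t (x e)    ≡⟨ sum-cong-≗ (λ t → cardᵢ≡∑hits x t) ⟨
    ∑[ t < k ] cardᵢ x t                  ∎
    where open ≡-Reasoning

  ≼-refl : ∀ {x : KTuple n k} → x ≼ x
  ≼-refl e i xe = xe

  ≼-trans : ∀ {x y z : KTuple n k} → x ≼ y → y ≼ z → x ≼ z
  ≼-trans x≼y y≼z e i xe = y≼z e i (x≼y e i xe)

  zero-≼ : ∀ {x : KTuple n k} → zeroT ≼ x
  zero-≼ e i ()

  ≼-set : ∀ {x : KTuple n k} e m → x e ≡ nothing → x ≼ set x e m
  ≼-set {x} e m xe e′ i xe′ with e′ ≟ e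
  ... | yes refl = contradiction (trans (sym xe) xe′) λ ()
  ... | no _ = xe′

  ≼-erase : ∀ {x w : KTuple n k} r → x ≼ w → x r ≡ nothing → x ≼ erase w r
  ≼-erase {x} {w} r x≼w xr e′ i xe′ with e′ ≟ r
  ... | yes refl = contradiction (trans (sym xr) xe′) λ ()
  ... | no _ = x≼w e′ i xe′

  update-mono : ∀ {x w : KTuple n k} e i → x ≼ w → update x e i ≼ update w e i
  update-mono e i x≼w e′ j xe′ with e′ ≟ e
  ... | yes _ = xe′
  ... | no _ = x≼w e′ j xe′

  hits-mono : ∀ {x w : KTuple n k} → x ≼ w → ∀ t e → hits t (x e) ℕ.≤ hits t (w e)
  hits-mono {x} {w} x≼w t e with x e in xe
  ... | nothing = z≤n
  ... | just s rewrite x≼w e s xe = ℕ.≤-refl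

  size-mono : ∀ {x w : KTuple n k} → x ≼ w → ∀ e → size (x e) ℕ.≤ size (w e)
  size-mono {x} {w} x≼w e with x e in xe
  ... | nothing = z≤n
  ... | just s rewrite x≼w e s xe = ℕ.≤-refl

  cardᵢ-mono : ∀ {x w : KTuple n k} → x ≼ w → ∀ t → cardᵢ x t ℕ.≤ cardᵢ w t
  cardᵢ-mono {x} {w} x≼w t =
    subst₂ ℕ._≤_ (sym (cardᵢ≡∑hits x t)) (sym (cardᵢ≡∑hits w t)) (∑-mono-≤ (hits-mono x≼w t))

  suppSize-mono : ∀ {x w : KTuple n k} → x ≼ w → suppSize x ℕ.≤ suppSize w
  suppSize-mono x≼w = ∑-mono-≤ (size-mono x≼w)

  cardᵢ-mono-< : ∀ {x w : KTuple n k} {e t} → x ≼ w → w e ≡ just t → x e ≡ nothing → cardᵢ x t ℕ.< cardᵢ w t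
  cardᵢ-mono-< {x} {w} {e} {t} x≼w we xe =
    subst₂ ℕ._<_ (sym (cardᵢ≡∑hits x t)) (sym (cardᵢ≡∑hits w t))
      (∑-mono-< (hits-mono x≼w t) e (subst₂ (λ m m′ → hits t m ℕ.< hits t m′) (sym xe) (sym we)
        (ℕ.≤-reflexive (sym (hits-self t)))))

  cardᵢ-<⇒∃ : ∀ {x w : KTuple n k} {t} → x ≼ w → cardᵢ x t ℕ.< cardᵢ w t → ∃ λ r → w r ≡ just t × x r ≡ nothing
  cardᵢ-<⇒∃ {x} {w} {t} x≼w cx<cw
    with ∑-<⇒∃< (λ e → hits t (x e)) (λ e → hits t (w e))
                (subst₂ ℕ._<_ (cardᵢ≡∑hits x t) (cardᵢ≡∑hits w t) cx<cw)
  ... | r , hx<hw with x r in xr | w r in wr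
  ...   | nothing | just s = r , trans wr (cong just (hits⇒≡ hx<hw)) , xr
  ...   | just s | _ with trans (sym wr) (x≼w r s xr)
  ...     | refl = contradiction hx<hw (ℕ.n≮n _)

  cardᵢ-zero : ∀ t → cardᵢ (zeroT {n} {k}) t ≡ 0
  cardᵢ-zero t = trans (cardᵢ≡∑hits zeroT t) (sum-replicate-zero n)

  suppSize-zero : suppSize (zeroT {n} {k}) ≡ 0
  suppSize-zero = sum-replicate-zero n

  cardᵢ-erase : ∀ (x : KTuple n k) r t → cardᵢ (erase x r) t ℕ.+ hits t (x r) ≡ cardᵢ x t
  cardᵢ-erase x r t = trans (cardᵢ-set x r nothing t) (ℕ.+-identityʳ _)

  cardᵢ-erase-≤ : ∀ (x : KTuple n k) r t → cardᵢ (erase x r) t ℕ.≤ cardᵢ x t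
  cardᵢ-erase-≤ x r t = subst (cardᵢ (erase x r) t ℕ.≤_) (cardᵢ-erase x r t) (ℕ.m≤m+n _ _)

  cardᵢ-update : ∀ {x : KTuple n k} e i t → x e ≡ nothing → cardᵢ (update x e i) t ≡ cardᵢ x t ℕ.+ hits t (just i)
  cardᵢ-update {x} e i t xe =
    trans (sym (ℕ.+-identityʳ _)) (trans (cong (λ m → cardᵢ (update x e i) t ℕ.+ hits t m) (sym xe))
                                         (cardᵢ-set x e (just i) t))

  suppSize-erase : ∀ (x : KTuple n k) r → suppSize (erase x r) ℕ.+ size (x r) ≡ suppSize x
  suppSize-erase x r = trans (suppSize-set x r nothing) (ℕ.+-identityʳ _)

  suppSize-update : ∀ {x : KTuple n k} e i → x e ≡ nothing → suppSize (update x e i) ≡ suc (suppSize x)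
  suppSize-update {x} e i xe =
    trans (sym (ℕ.+-identityʳ _)) (trans (cong (λ m → suppSize (update x e i) ℕ.+ size m) (sym xe))
                                         (trans (suppSize-set x e (just i)) (ℕ.+-comm _ 1)))

  Feasible : (Fin k → ℕ) → KTuple n k → Set
  Feasible B x = ∀ t → cardᵢ x t ℕ.≤ B t

  Active : (Fin k → ℕ) → KTuple n k → (Fin k → Bool) → Set
  Active B x I = (∀ t → I t ≡ true → cardᵢ x t ℕ.< B t) × (∀ t → I t ≡ false → cardᵢ x t ≡ B t)

  Feasible-erase : ∀ {B} {w : KTuple n k} r → Feasible B w → Feasible B (erase w r)
  Feasible-erase {w = w} r w-feasible t = ℕ.≤-trans (cardᵢ-erase-≤ w r t) (w-feasible t)

  Active⇒colour-active : ∀ {B x I} {o : KTuple n k} {r t} → Active B x I → x ≼ o → Feasible B o →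
                         o r ≡ just t → x r ≡ nothing → I t ≡ true
  Active⇒colour-active {I = I} {t = t} (_ , full) x≼o o-feasible or xr with I t in It
  ... | true = refl
  ... | false = contradiction (subst (ℕ._< _) (full t It) (ℕ.<-≤-trans (cardᵢ-mono-< x≼o or xr) (o-feasible t)))
                              (ℕ.n≮n _)

  saturated⇒maximal : ∀ {B} {x o : KTuple n k} → (∀ t → cardᵢ x t ≡ B t) → x ≼ o → Feasible B o → o ≼ x
  saturated⇒maximal {x = x} {o} full x≼o o-feasible e t oe with x e in xe
  ... | just s = trans (sym (x≼o e s xe)) oe
  ... | nothing = contradiction (subst (ℕ._< _) (full t) (ℕ.<-≤-trans (cardᵢ-mono-< x≼o oe xe) (o-feasible t)))
                                (ℕ.n≮n _)

  erase-empty : ∀ {w : KTuple n k} r → w r ≡ nothing → ∀ j → erase w r j ≡ w j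
  erase-empty {w} r wr j with j ≟ r
  ... | yes refl = sym wr
  ... | no _ = refl

  erase-keeps-empty : ∀ {w : KTuple n k} {e} r → w e ≡ nothing → erase w r e ≡ nothing
  erase-keeps-empty {w} {e} r we with e ≟ r
  ... | yes _ = refl
  ... | no _ = we

  Active-update : ∀ {B} {x : KTuple n k} {I e i} → x e ≡ nothing → I i ≡ true → Active B x I →
    Active B (update x e i) (λ j → if ⌊ j ≟ i ⌋ ∧ ⌊ cardᵢ (update x e i) i ℕ.≟ B i ⌋ then false else I j)
  Active-update {B} {x} {I} {e} {i} xe Ii (open-below , closed-full) = open-below′ , closed-full′
    where
    x′ = update x e i
    cardᵢ-other : ∀ {t} → t ≢ i → cardᵢ x′ t ≡ cardᵢ x t
    cardᵢ-other t≢i = trans (cardᵢ-update e i _ xe) (trans (cong (cardᵢ x _ ℕ.+_) (hits-other (≢-sym t≢i))) (ℕ.+-identityʳ _))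
    cardᵢ-self : cardᵢ x′ i ≡ suc (cardᵢ x i)
    cardᵢ-self = trans (cardᵢ-update e i i xe) (trans (cong (cardᵢ x i ℕ.+_) (hits-self i)) (ℕ.+-comm _ 1))
    open-below′ : ∀ t → (if ⌊ t ≟ i ⌋ ∧ ⌊ cardᵢ x′ i ℕ.≟ B i ⌋ then false else I t) ≡ true → cardᵢ x′ t ℕ.< B t
    open-below′ t h with t ≟ i
    open-below′ t h | no t≢i = subst (ℕ._< B t) (sym (cardᵢ-other t≢i)) (open-below t h)
    open-below′ t h | yes refl with cardᵢ x′ t ℕ.≟ B t
    open-below′ t () | yes refl | yes _
    open-below′ t h | yes refl | no x′≢B = ℕ.≤∧≢⇒< (subst (ℕ._≤ B t) (sym cardᵢ-self) (open-below t Ii)) x′≢B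
    closed-full′ : ∀ t → (if ⌊ t ≟ i ⌋ ∧ ⌊ cardᵢ x′ i ℕ.≟ B i ⌋ then false else I t) ≡ false → cardᵢ x′ t ≡ B t
    closed-full′ t h with t ≟ i
    closed-full′ t h | no t≢i = trans (cardᵢ-other t≢i) (closed-full t h)
    closed-full′ t h | yes refl with cardᵢ x′ t ℕ.≟ B t
    closed-full′ t h | yes refl | yes x′≡B = x′≡B
    closed-full′ t h | yes refl | no _ = contradiction (trans (sym Ii) h) λ ()

module OrderedFieldProperties (R : OrderedField) where
  open OrderedField R

  commutativeRing : CommutativeRing _ _
  commutativeRing = record { isCommutativeRing = isCommutativeRing }

  open CommutativeRing commutativeRing public
    using (+-assoc; +-comm; +-identityˡ; +-identityʳ; -‿inverseˡ; -‿inverseʳ; *-comm; distribˡ; distribʳ; zeroˡ; zeroʳ)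
  open import Algebra.Properties.Ring (CommutativeRing.ring commutativeRing) public
    using (-‿distribʳ-*; -1*x≈-x; -‿involutive)
  open IsTotalOrder isTotalOrder public
    using (total; antisym) renaming (refl to ≤-refl; trans to ≤-trans; reflexive to ≤-reflexive)
  open import Algebra.Solver.Ring.NaturalCoefficients.Default
    (CommutativeRing.commutativeSemiring commutativeRing) public
    using (solve; _:=_; _:+_; _:*_; con)

  poset : Poset _ _ _
  poset = record { isPartialOrder = IsTotalOrder.isPartialOrder isTotalOrder }

  module ≤-Reasoning = Relation.Binary.Reasoning.PartialOrder poset

  +-monoʳ-≤ : ∀ {x y} z → x ≤ y → z + x ≤ z + y
  +-monoʳ-≤ {x} {y} z x≤y = subst₂ _≤_ (+-comm x z) (+-comm y z) (+-monoˡ-≤ z x≤y)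

  +-mono-≤ : ∀ {x y u v} → x ≤ y → u ≤ v → x + u ≤ y + v
  +-mono-≤ {y = y} {u} x≤y u≤v = ≤-trans (+-monoˡ-≤ u x≤y) (+-monoʳ-≤ y u≤v)

  x-y+y≡x : ∀ x y → x - y + y ≡ x
  x-y+y≡x x y = trans (+-assoc x (- y) y) (trans (cong (x +_) (-‿inverseˡ y)) (+-identityʳ x))

  x+y-y≡x : ∀ x y → x + y - y ≡ x
  x+y-y≡x x y = trans (+-assoc x y (- y)) (trans (cong (x +_) (-‿inverseʳ y)) (+-identityʳ x))

  +-cancelʳ-≤ : ∀ {x y} z → x + z ≤ y + z → x ≤ y
  +-cancelʳ-≤ {x} {y} z x+z≤y+z = subst₂ _≤_ (x+y-y≡x x z) (x+y-y≡x y z) (+-monoˡ-≤ (- z) x+z≤y+z)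

  x-y≤u-v⇒x+v≤u+y : ∀ {x y u v} → x - y ≤ u - v → x + v ≤ u + y
  x-y≤u-v⇒x+v≤u+y {x} {y} {u} {v} x-y≤u-v = subst₂ _≤_ (lhs x y v) (trans (cong (u - v +_) (+-comm y v)) (lhs u v y))
                                            (+-monoˡ-≤ (y + v) x-y≤u-v)
    where
    lhs : ∀ x y v → x - y + (y + v) ≡ x + v
    lhs x y v = begin
      x - y + (y + v)     ≡⟨ +-assoc x (- y) (y + v) ⟩
      x + (- y + (y + v)) ≡⟨ cong (x +_) (+-assoc (- y) y v) ⟨
      x + (- y + y + v)   ≡⟨ cong (λ z → x + (z + v)) (-‿inverseˡ y) ⟩
      x + (0# + v)        ≡⟨ cong (x +_) (+-identityˡ v) ⟩
      x + v               ∎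
      where open ≡-Reasoning

  x≤y⇒0≤y-x : ∀ {x y} → x ≤ y → 0# ≤ y - x
  x≤y⇒0≤y-x {x} {y} x≤y = subst (_≤ y - x) (-‿inverseʳ x) (+-monoˡ-≤ (- x) x≤y)

  0≤y-x⇒x≤y : ∀ {x y} → 0# ≤ y - x → x ≤ y
  0≤y-x⇒x≤y {x} {y} 0≤y-x = subst₂ _≤_ (+-identityˡ x) (x-y+y≡x y x) (+-monoˡ-≤ x 0≤y-x)

  *-monoˡ-≤ : ∀ {x y} c → 0# ≤ c → x ≤ y → c * x ≤ c * y
  *-monoˡ-≤ {x} {y} c 0≤c x≤y = 0≤y-x⇒x≤y (subst (0# ≤_) c[y-x]≡cy-cx (*-nonneg 0≤c (x≤y⇒0≤y-x x≤y)))
    where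
    c[y-x]≡cy-cx : c * (y - x) ≡ c * y - c * x
    c[y-x]≡cy-cx = trans (distribˡ c y (- x)) (cong (c * y +_) (sym (-‿distribʳ-* c x)))

  *-monoʳ-≤ : ∀ {x y} c → 0# ≤ c → x ≤ y → x * c ≤ y * c
  *-monoʳ-≤ {x} {y} c 0≤c x≤y = subst₂ _≤_ (*-comm c x) (*-comm c y) (*-monoˡ-≤ c 0≤c x≤y)

  +-nonneg : ∀ {x y} → 0# ≤ x → 0# ≤ y → 0# ≤ x + y
  +-nonneg 0≤x 0≤y = subst (_≤ _) (+-identityʳ 0#) (+-mono-≤ 0≤x 0≤y)

  -- if 1 ≤ 0 then 0 ≤ -1, so 0 ≤ (-1)(-1) = 1 anyway
  0≤1 : 0# ≤ 1#
  0≤1 with total 0# 1#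
  ... | inj₁ 0≤1 = 0≤1
  ... | inj₂ 1≤0 = subst (0# ≤_) (-1*-1≡1) (*-nonneg 0≤-1 0≤-1)
    where
    0≤-1 : 0# ≤ - 1#
    0≤-1 = subst₂ _≤_ (-‿inverseʳ 1#) (+-identityˡ (- 1#)) (+-monoˡ-≤ (- 1#) 1≤0)
    -1*-1≡1 : - 1# * - 1# ≡ 1#
    -1*-1≡1 = trans (-1*x≈-x (- 1#)) (-‿involutive 1#)

  fromℕ-+ : ∀ m m′ → fromℕ (m ℕ.+ m′) ≡ fromℕ m + fromℕ m′
  fromℕ-+ zero m′ = sym (+-identityˡ _)
  fromℕ-+ (suc m) m′ = trans (cong (1# +_) (fromℕ-+ m m′)) (sym (+-assoc 1# _ _))

  fromℕ-nonneg : ∀ m → 0# ≤ fromℕ m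
  fromℕ-nonneg zero = ≤-refl
  fromℕ-nonneg (suc m) = +-nonneg 0≤1 (fromℕ-nonneg m)

  fromℕ-mono-≤ : ∀ {m m′} → m ℕ.≤ m′ → fromℕ m ≤ fromℕ m′
  fromℕ-mono-≤ {m′ = m′} z≤n = fromℕ-nonneg m′
  fromℕ-mono-≤ (s≤s m≤m′) = +-monoʳ-≤ 1# (fromℕ-mono-≤ m≤m′)

  fromℕ-1* : ∀ x → fromℕ 1 * x ≡ x
  fromℕ-1* = solve 1 (λ x → (con 1 :+ con 0) :* x := x) refl

  weighted-loss-trans : ∀ {X Y Z p s} m m′ → X + m * p ≤ Y + m * s → Y + m′ * p ≤ Z + m′ * s →
                   X + (m + m′) * p ≤ Z + (m + m′) * s
  weighted-loss-trans {X} {Y} {Z} {p} {s} m m′ X≤Y Y≤Z = begin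
    X + (m + m′) * p       ≡⟨ solve 4 (λ X m m′ p → X :+ (m :+ m′) :* p := X :+ m :* p :+ m′ :* p) refl X m m′ p ⟩
    X + m * p + m′ * p     ≤⟨ +-monoˡ-≤ (m′ * p) X≤Y ⟩
    Y + m * s + m′ * p     ≡⟨ solve 5 (λ Y m m′ p s → Y :+ m :* s :+ m′ :* p := Y :+ m′ :* p :+ m :* s) refl Y m m′ p s ⟩
    Y + m′ * p + m * s     ≤⟨ +-monoˡ-≤ (m * s) Y≤Z ⟩
    Z + m′ * s + m * s     ≡⟨ solve 4 (λ Z m m′ s → Z :+ m′ :* s :+ m :* s := Z :+ (m :+ m′) :* s) refl Z m m′ s ⟩
    Z + (m + m′) * s       ∎
    where open ≤-Reasoning

  -- the weight m of the loss is topped up to 2 with the nonnegative (2 - m)(q - p)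
  reweight≤2 : ∀ {X Y p q g} m → m ℕ.≤ 2 → p ≤ q → X + fromℕ m * p ≤ Y + fromℕ m * (q + g) →
               X + (p + p) ≤ Y + (q + q) + fromℕ m * g
  reweight≤2 {X} {Y} {p} {q} {g} m m≤2 p≤q X≤Y = begin
    X + (p + p)                               ≡⟨ cong (X +_) (two* p) ⟨
    X + fromℕ 2 * p                           ≡⟨ cong (λ z → X + z * p) two≡ ⟨
    X + (M + M′) * p                          ≡⟨ solve 4 (λ X M M′ p → X :+ (M :+ M′) :* p := X :+ M :* p :+ M′ :* p) refl X M M′ p ⟩
    X + M * p + M′ * p                        ≤⟨ +-mono-≤ X≤Y (*-monoˡ-≤ M′ (fromℕ-nonneg (2 ℕ.∸ m)) p≤q) ⟩
    Y + M * (q + g) + M′ * q                  ≡⟨ solve 5 (λ Y M M′ q g → Y :+ M :* (q :+ g) :+ M′ :* q := Y :+ (M :+ M′) :* q :+ M :* g) refl Y M M′ q g ⟩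
    Y + (M + M′) * q + M * g                  ≡⟨ cong (λ z → Y + z * q + M * g) two≡ ⟩
    Y + fromℕ 2 * q + M * g                   ≡⟨ cong (λ z → Y + z + M * g) (two* q) ⟩
    Y + (q + q) + M * g                       ∎
    where
    open ≤-Reasoning
    M M′ : Carrier
    M = fromℕ m
    M′ = fromℕ (2 ℕ.∸ m)
    two≡ : M + M′ ≡ fromℕ 2
    two≡ = trans (sym (fromℕ-+ m (2 ℕ.∸ m))) (cong fromℕ (ℕ.m+[n∸m]≡n m≤2))
    two* : ∀ x → fromℕ 2 * x ≡ x + x
    two* = solve 1 (λ x → (con 1 :+ (con 1 :+ con 0)) :* x := x :+ x) refl

module GreedyAnalysis (R : OrderedField) where
  open OrderedField R
  open OrderedFieldProperties R

  module Run {n k : ℕ}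
    (ε : Carrier) (0≤ε : 0# ≤ ε) (ε≤1 : ε ≤ 1#) (B : Fin k → ℕ)
    (F f : KTuple n k → Carrier) (f-mono : Monotone R f) (f-submodular : KSubmodular R f) (f-zero : f zeroT ≡ 0#)
    (F≈f : ∀ x → ((1# - ε) * f x ≤ F x) × (F x ≤ (1# + ε) * f x))
    (xᵀ : KTuple n k) (Iᵀ : Fin k → Bool) (Iᵀ-empty : ∀ t → Iᵀ t ≡ false)
    where

    a c G γ D : Carrier
    a = 1# - ε
    c = fromℕ 2 * ε
    G = f xᵀ
    γ = c * G
    D = fromℕ 3 * (a * G)

    T : ℕ → Carrier
    T m = fromℕ m * γ

    0≤a : 0# ≤ a
    0≤a = x≤y⇒0≤y-x ε≤1

    0≤c : 0# ≤ c
    0≤c = *-nonneg (fromℕ-nonneg 2) 0≤ε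

    0≤G : 0# ≤ G
    0≤G = subst (_≤ G) f-zero (f-mono zeroT xᵀ zero-≼)

    1+ε≡a+c : 1# + ε ≡ a + c
    1+ε≡a+c = begin
      1# + ε                  ≡⟨ cong (_+ ε) (x-y+y≡x 1# ε) ⟨
      1# - ε + ε + ε          ≡⟨ solve 2 (λ a ε → a :+ ε :+ ε := a :+ (con 1 :+ (con 1 :+ con 0)) :* ε) refl a ε ⟩
      a + c                   ∎
      where open ≡-Reasoning

    T-+ : ∀ m m′ → T (m ℕ.+ m′) ≡ T m + T m′
    T-+ m m′ = trans (cong (_* γ) (fromℕ-+ m m′)) (distribʳ γ (fromℕ m) (fromℕ m′))

    T-mono : ∀ {m m′} → m ℕ.≤ m′ → T m ≤ T m′
    T-mono m≤m′ = *-monoʳ-≤ γ (*-nonneg 0≤c 0≤G) (fromℕ-mono-≤ m≤m′)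

    f-cong : ∀ {u v} → (∀ e → u e ≡ v e) → f u ≡ f v
    f-cong {u} {v} u≗v = antisym (f-mono u v (λ e i ue → trans (sym (u≗v e)) ue))
                                 (f-mono v u (λ e i ve → trans (u≗v e) ve))

    af-mono : ∀ {u v} → u ≼ v → a * f u ≤ a * f v
    af-mono {u} {v} u≼v = *-monoˡ-≤ a 0≤a (f-mono u v u≼v)

    Potential : KTuple n k → KTuple n k → Set
    Potential x o = a * f o + (a * f x + a * f x) + T (suppSize x) ≤ D + T (suppSize o)

    potential-final : Active B xᵀ Iᵀ → ∀ {o} → xᵀ ≼ o → Feasible B o → Potential xᵀ o
    potential-final (_ , closed-full) {o} xᵀ≼o o-feasible = begin
      a * f o + (a * G + a * G) + T (suppSize xᵀ)   ≤⟨ +-mono-≤ (+-monoˡ-≤ _ (af-mono o≼xᵀ)) (T-mono (suppSize-mono xᵀ≼o)) ⟩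
      a * G + (a * G + a * G) + T (suppSize o)      ≡⟨ cong (_+ T (suppSize o)) (three* (a * G)) ⟩
      D + T (suppSize o)                            ∎
      where
      open ≤-Reasoning
      o≼xᵀ : o ≼ xᵀ
      o≼xᵀ = saturated⇒maximal (λ t → closed-full t (Iᵀ-empty t)) xᵀ≼o o-feasible
      three* : ∀ x → x + (x + x) ≡ fromℕ 3 * x
      three* = solve 1 (λ x → x :+ (x :+ x) := (con 1 :+ (con 1 :+ (con 1 :+ con 0))) :* x) refl

    module Step {x I e i}
      (greedy : ∀ e′ i′ → x e′ ≡ nothing → I i′ ≡ true → Δ R F x e′ i′ ≤ Δ R F x e i)
      (xe : x e ≡ nothing) (Ii : I i ≡ true) (active : Active B x I) (x′≼xᵀ : update x e i ≼ xᵀ)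
      where

      x′ : KTuple n k
      x′ = update x e i

      p q : Carrier
      p = a * f x
      q = a * f x′

      p≤q : p ≤ q
      p≤q = af-mono (≼-set e (just i) xe)

      greedy-gain : ∀ {r t} → x r ≡ nothing → I t ≡ true → a * f (update x r t) ≤ q + γ
      greedy-gain {r} {t} xr It = begin
        a * f u              ≤⟨ proj₁ (F≈f u) ⟩
        F u                  ≤⟨ +-cancelʳ-≤ (- F x) (greedy r t xr It) ⟩
        F x′                 ≤⟨ proj₂ (F≈f x′) ⟩
        (1# + ε) * f x′      ≡⟨ cong (_* f x′) 1+ε≡a+c ⟩
        (a + c) * f x′       ≡⟨ distribʳ (f x′) a c ⟩
        q + c * f x′         ≤⟨ +-monoʳ-≤ q (*-monoˡ-≤ c 0≤c (f-mono x′ xᵀ x′≼xᵀ)) ⟩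
        q + γ                ∎
        where
        open ≤-Reasoning
        u = update x r t

      -- diminishing returns of f at x ≼ w \ r, then the greedy choice bounds the marginal gain at x
      erase-occupied-loss : ∀ {w r t} → x ≼ w → x r ≡ nothing → w r ≡ just t → I t ≡ true →
                            a * f w + p ≤ a * f (erase w r) + (q + γ)
      erase-occupied-loss {w} {r} {t} x≼w xr wr It = begin
        a * f w + a * f x        ≡⟨ distribˡ a (f w) (f x) ⟨
        a * (f w + f x)          ≤⟨ *-monoˡ-≤ a 0≤a (x-y≤u-v⇒x+v≤u+y diminishing) ⟩
        a * (f u + f w⁻)         ≡⟨ distribˡ a (f u) (f w⁻) ⟩
        a * f u + a * f w⁻       ≤⟨ +-monoˡ-≤ (a * f w⁻) (greedy-gain xr It) ⟩
        q + γ + a * f w⁻         ≡⟨ +-comm (q + γ) (a * f w⁻) ⟩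
        a * f w⁻ + (q + γ)       ∎
        where
        open ≤-Reasoning
        u = update x r t
        w⁻ = erase w r
        restore : ∀ j → update w⁻ r t j ≡ w j
        restore j with j ≟ r
        ... | yes refl = sym wr
        ... | no _ = refl
        diminishing : f w - f w⁻ ≤ f u - f x
        diminishing = subst (λ z → z - f w⁻ ≤ f u - f x) (f-cong restore)
                            (proj₁ f-submodular x w⁻ (≼-erase r x≼w xr) r (set-here w r nothing) t)

      erase-loss : ∀ {w} r → x ≼ w → Feasible B w → x r ≡ nothing →
                   a * f w + fromℕ (size (w r)) * p ≤ a * f (erase w r) + fromℕ (size (w r)) * (q + γ)
      erase-loss {w} r x≼w w-feasible xr with w r in wr
      ... | nothing = ≤-reflexive (cong₂ _+_ (cong (a *_) (sym (f-cong (erase-empty r wr))))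
                                             (trans (zeroˡ p) (sym (zeroˡ (q + γ)))))
      ... | just t = subst₂ _≤_ (cong (a * f w +_) (sym (fromℕ-1* p))) (cong (a * f (erase w r) +_) (sym (fromℕ-1* (q + γ))))
                            (erase-occupied-loss x≼w xr wr (Active⇒colour-active active x≼w w-feasible wr xr))

      -- while colour i has room, the slot r = e is returned: it is empty, so erasing it is free
      make-room : ∀ {w} → x ≼ w → w e ≡ nothing → Feasible B w →
                  ∃ λ r → x r ≡ nothing × cardᵢ (erase w r) i ℕ.< B i
      make-room {w} x≼w we w-feasible with cardᵢ w i ℕ.<? B i
      ... | yes w<B = e , xe , subst (ℕ._< B i) (sym erase-e) w<B
        where
        erase-e : cardᵢ (erase w e) i ≡ cardᵢ w i
        erase-e = trans (sym (ℕ.+-identityʳ _)) (trans (cong (λ m → cardᵢ (erase w e) i ℕ.+ hits i m) (sym we))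
                                                       (cardᵢ-erase w e i))
      ... | no w≮B with cardᵢ-<⇒∃ x≼w (ℕ.<-≤-trans (proj₁ active i Ii) (ℕ.≮⇒≥ w≮B))
      ...   | r , wr , xr = r , xr , subst (ℕ._≤ B i) erase-r (w-feasible i)
        where
        erase-r : cardᵢ w i ≡ suc (cardᵢ (erase w r) i)
        erase-r = begin
          cardᵢ w i                                 ≡⟨ cardᵢ-erase w r i ⟨
          cardᵢ (erase w r) i ℕ.+ hits i (w r)      ≡⟨ cong (λ m → cardᵢ (erase w r) i ℕ.+ hits i m) wr ⟩
          cardᵢ (erase w r) i ℕ.+ hits i (just i)   ≡⟨ cong (cardᵢ (erase w r) i ℕ.+_) (hits-self i) ⟩
          cardᵢ (erase w r) i ℕ.+ 1                 ≡⟨ ℕ.+-comm _ 1 ⟩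
          suc (cardᵢ (erase w r) i)                 ∎
          where open ≡-Reasoning

      record Exchange (o : KTuple n k) : Set where
        field
          o′ : KTuple n k
          κ : ℕ
          x′≼o′ : x′ ≼ o′
          o′-feasible : Feasible B o′
          loss : a * f o + (p + p) ≤ a * f o′ + (q + q) + T κ
          size-o′ : suppSize o′ ℕ.+ κ ≡ suc (suppSize o)

      module Exchanging {o} (x≼o : x ≼ o) (o-feasible : Feasible B o) where

        w : KTuple n k
        w = erase o e

        x≼w : x ≼ w
        x≼w = ≼-erase e x≼o xe

        w-feasible : Feasible B w
        w-feasible = Feasible-erase e o-feasible

        module _ {r} (xr : x r ≡ nothing) (w₂<B : cardᵢ (erase w r) i ℕ.< B i) where

          w₂ o′ : KTuple n k
          w₂ = erase w r
          o′ = update w₂ e i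

          w₂e : w₂ e ≡ nothing
          w₂e = erase-keeps-empty {w = w} r (set-here o e nothing)

          κ : ℕ
          κ = size (o e) ℕ.+ size (w r)

          o′-feasible : Feasible B o′
          o′-feasible t = subst (ℕ._≤ B t) (sym (cardᵢ-update e i t w₂e)) (bound t)
            where
            bound : ∀ t → cardᵢ w₂ t ℕ.+ hits t (just i) ℕ.≤ B t
            bound t with i ≟ t
            ... | yes refl = subst (ℕ._≤ B i) (ℕ.+-comm 1 _) w₂<B
            ... | no _ = subst (ℕ._≤ B t) (sym (ℕ.+-identityʳ _)) (Feasible-erase r w-feasible t)

          weighted-loss : a * f o + fromℕ κ * p ≤ a * f o′ + fromℕ κ * (q + γ)
          weighted-loss = subst (λ z → a * f o + z * p ≤ a * f o′ + z * (q + γ)) (sym (fromℕ-+ (size (o e)) (size (w r))))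
            (weighted-loss-trans (fromℕ (size (o e))) (fromℕ (size (w r))) (erase-loss e x≼o o-feasible xe)
              (≤-trans (erase-loss r x≼w w-feasible xr) (+-monoˡ-≤ _ (af-mono (≼-set e (just i) w₂e)))))

          size-o′ : suppSize o′ ℕ.+ κ ≡ suc (suppSize o)
          size-o′ = begin
            suppSize o′ ℕ.+ (size (o e) ℕ.+ size (w r))       ≡⟨ cong (ℕ._+ κ) (suppSize-update e i w₂e) ⟩
            suc (suppSize w₂ ℕ.+ (size (o e) ℕ.+ size (w r))) ≡⟨ cong suc (swap-last (suppSize w₂) (size (o e)) _) ⟩
            suc (suppSize w₂ ℕ.+ size (w r) ℕ.+ size (o e))   ≡⟨ cong (λ s → suc (s ℕ.+ size (o e))) (suppSize-erase w r) ⟩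
            suc (suppSize w ℕ.+ size (o e))                   ≡⟨ cong suc (suppSize-erase o e) ⟩
            suc (suppSize o)                                  ∎
            where
            open ≡-Reasoning
            swap-last : ∀ l m m′ → l ℕ.+ (m ℕ.+ m′) ≡ l ℕ.+ m′ ℕ.+ m
            swap-last = solve-∀

          exchange-via : Exchange o
          exchange-via = record
            { o′ = o′
            ; κ = κ
            ; x′≼o′ = update-mono e i (≼-erase r x≼w xr)
            ; o′-feasible = o′-feasible
            ; loss = reweight≤2 κ (ℕ.+-mono-≤ (size≤1 (o e)) (size≤1 (w r))) p≤q weighted-loss
            ; size-o′ = size-o′
            }

        exchange : Exchange o
        exchange with make-room x≼w (set-here o e nothing) w-feasible
        ... | r , xr , w₂<B = exchange-via xr w₂<B

      potential-step : (∀ {o′} → x′ ≼ o′ → Feasible B o′ → Potential x′ o′) →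
                       ∀ {o} → x ≼ o → Feasible B o → Potential x o
      potential-step potential′ {o} x≼o o-feasible = +-cancelʳ-≤ γ (begin
        a * f o + (p + p) + T (suppSize x) + γ                  ≤⟨ +-monoˡ-≤ γ (+-monoˡ-≤ (T (suppSize x)) loss) ⟩
        a * f o′ + (q + q) + T κ + T (suppSize x) + γ            ≡⟨ solve 4 (λ A Tκ X g → A :+ Tκ :+ X :* g :+ g := A :+ (con 1 :+ X) :* g :+ Tκ)
                                                                           refl (a * f o′ + (q + q)) (T κ) (fromℕ (suppSize x)) γ ⟩
        a * f o′ + (q + q) + T (suc (suppSize x)) + T κ          ≡⟨ cong (λ m → a * f o′ + (q + q) + T m + T κ) (suppSize-update e i xe) ⟨
        a * f o′ + (q + q) + T (suppSize x′) + T κ               ≤⟨ +-monoˡ-≤ (T κ) (potential′ x′≼o′ o′-feasible) ⟩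
        D + T (suppSize o′) + T κ                                ≡⟨ trans (+-assoc D _ _) (cong (D +_) (sym (T-+ (suppSize o′) κ))) ⟩
        D + T (suppSize o′ ℕ.+ κ)                                ≡⟨ cong (λ m → D + T m) size-o′ ⟩
        D + T (suc (suppSize o))                                 ≡⟨ solve 3 (λ D O g → D :+ (con 1 :+ O) :* g := D :+ O :* g :+ g)
                                                                           refl D (fromℕ (suppSize o)) γ ⟩
        D + T (suppSize o) + γ                                   ∎)
        where
        open ≤-Reasoning
        open Exchange (Exchanging.exchange x≼o o-feasible)

    reaches : ∀ {x I} → Star (GreedyStep R F B) (x , I) (xᵀ , Iᵀ) → x ≼ xᵀ
    reaches ε⋆ = ≼-refl
    reaches ((e , i , xe , _ , _ , refl , refl) ◅ run) = ≼-trans (≼-set e (just i) xe) (reaches run)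

    potential-run : ∀ {x I} → Star (GreedyStep R F B) (x , I) (xᵀ , Iᵀ) → Active B x I →
                    ∀ {o} → x ≼ o → Feasible B o → Potential x o
    potential-run ε⋆ active = potential-final active
    potential-run ((e , i , xe , Ii , greedy , refl , refl) ◅ run) active =
      Step.potential-step greedy xe Ii active (reaches run) (potential-run run (Active-update {n} xe Ii active))

    optimum-bound : Star (GreedyStep R F B) (zeroT , λ _ → true) (xᵀ , Iᵀ) → (∀ t → 1 ℕ.≤ B t) →
                    ∀ {y} → Feasible B y → a * f y ≤ D + T (totalB B)
    optimum-bound run B≥1 {y} y-feasible = begin
      a * f y                                             ≡⟨ initial ⟨
      a * f y + (a * f x₀ + a * f x₀) + T (suppSize x₀)   ≤⟨ potential-run run active₀ zero-≼ y-feasible ⟩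
      D + T (suppSize y)                                  ≤⟨ +-monoʳ-≤ D (T-mono suppSize≤totalB) ⟩
      D + T (totalB B)                                    ∎
      where
      open ≤-Reasoning
      x₀ : KTuple n k
      x₀ = zeroT
      active₀ : Active B x₀ (λ _ → true)
      active₀ = (λ t _ → subst (ℕ._< B t) (sym (cardᵢ-zero {n} t)) (B≥1 t)) , λ t ()
      initial : a * f y + (a * f x₀ + a * f x₀) + T (suppSize x₀) ≡ a * f y
      initial = trans (cong₂ (λ u m → a * f y + (a * u + a * u) + T m) f-zero (suppSize-zero {n} {k}))
                      (solve 3 (λ A a g → A :+ (a :* con 0 :+ a :* con 0) :+ con 0 :* g := A) refl (a * f y) a γ)
      suppSize≤totalB : suppSize y ℕ.≤ totalB B
      suppSize≤totalB = subst₂ ℕ._≤_ (sym (suppSize≡∑cardᵢ y)) (sym (totalB≡∑ B)) (∑-mono-≤ y-feasible)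

    greedyFactor : ℕ → Carrier
    greedyFactor N = fromℕ 3 - fromℕ 3 * ε + fromℕ 2 * ε * fromℕ N

    greedyFactor≡ : ∀ N → greedyFactor N ≡ fromℕ 3 * a + c * fromℕ N
    greedyFactor≡ N = trans (cong (λ z → fromℕ 3 + z + c * fromℕ N) (-‿distribʳ-* (fromℕ 3) ε))
      (solve 3 (λ m c N → three :+ three :* m :+ c :* N := three :* (con 1 :+ m) :+ c :* N) refl (- ε) c (fromℕ N))
      where three = con 1 :+ (con 1 :+ (con 1 :+ con 0))

    greedyFactor-nonneg : ∀ N → 0# ≤ greedyFactor N
    greedyFactor-nonneg N = subst (0# ≤_) (sym (greedyFactor≡ N))
      (+-nonneg (*-nonneg (fromℕ-nonneg 3) 0≤a) (*-nonneg 0≤c (fromℕ-nonneg N)))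

    D+T≡greedyFactor*G : ∀ N → D + T N ≡ greedyFactor N * G
    D+T≡greedyFactor*G N = trans
      (solve 5 (λ t a N c G → t :* (a :* G) :+ N :* (c :* G) := (t :* a :+ c :* N) :* G) refl (fromℕ 3) a (fromℕ N) c G)
      (cong (_* G) (sym (greedyFactor≡ N)))

    approximation : ∀ {Q y} → 0# ≤ Q → a * f y ≤ Q * G → (a * a) * F y ≤ F xᵀ * (Q * (1# + ε))
    approximation {Q} {y} 0≤Q af≤QG = begin
      (a * a) * F y                ≤⟨ *-monoˡ-≤ (a * a) (*-nonneg 0≤a 0≤a) (proj₂ (F≈f y)) ⟩
      (a * a) * ((1# + ε) * f y)   ≡⟨ solve 3 (λ a b u → (a :* a) :* (b :* u) := (a :* b) :* (a :* u)) refl a (1# + ε) (f y) ⟩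
      (a * (1# + ε)) * (a * f y)   ≤⟨ *-monoˡ-≤ _ (*-nonneg 0≤a 0≤1+ε) af≤QG ⟩
      (a * (1# + ε)) * (Q * G)     ≡⟨ solve 4 (λ a b Q G → (a :* b) :* (Q :* G) := (Q :* b) :* (a :* G)) refl a (1# + ε) Q G ⟩
      (Q * (1# + ε)) * (a * G)     ≤⟨ *-monoˡ-≤ _ (*-nonneg 0≤Q 0≤1+ε) (proj₁ (F≈f xᵀ)) ⟩
      (Q * (1# + ε)) * F xᵀ        ≡⟨ *-comm _ (F xᵀ) ⟩
      F xᵀ * (Q * (1# + ε))        ∎
      where
      open ≤-Reasoning
      0≤1+ε : 0# ≤ 1# + ε
      0≤1+ε = +-nonneg 0≤1 0≤ε

theorem6 : (R : OrderedField) → let open OrderedField R in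
    (n k : ℕ) → 1 ℕ.≤ k → (ε : Carrier) → 0# < ε → ε < 1# →
    (B : Fin k → ℕ) → (∀ i → 1 ℕ.≤ B i) →
    totalB B ℕ.≤ n →
    (F : KTuple n k → Carrier) → (∀ x → 0# ≤ F x) →
    ApproxKSubmodular R ε F →
    (x : KTuple n k) → GreedyOutput R F B x →
    (y : KTuple n k) → (∀ i → cardᵢ y i ℕ.≤ B i) →
    ((1# - ε) * (1# - ε)) * F y
      ≤ F x * ((fromℕ 3 - fromℕ 3 * ε + fromℕ 2 * ε * fromℕ (totalB B)) * (1# + ε))
theorem6 R n k _ ε (0≤ε , _) (ε≤1 , _) B B≥1 _ F _ (f , f-mono , f-submodular , f-zero , _ , F≈f)
         x (I , run , I-empty) y y-feasible =
  approximation (greedyFactor-nonneg (totalB B))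
    (subst (a * f y ≤_) (D+T≡greedyFactor*G (totalB B)) (optimum-bound run B≥1 y-feasible))
  where
  open OrderedField R using (_*_; _≤_)
  open GreedyAnalysis.Run R ε 0≤ε ε≤1 B F f f-mono f-submodular f-zero F≈f x I I-empty
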